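{- The sequence $(\overline{C_n})_{n\ge 6}$ of complements of cycles is an antichain for the induced minor relation, i.e. for all distinct $m,n \ge 6$, $\overline{C_m}$ is not an induced minor of $\overline{C_n}$.
   Context: $C_n$ is the cycle on $n$ vertices and $\overline{G}$ denotes the complement of a graph $G$. $H$ is an induced minor of $G$ if $H$ can be obtained from $G$ by vertex deletions and edge contractions. -}

module Defs where

open import Data.Nat using (ℕ; zero; suc; _+_; _%_)
import Data.Nat.Properties as ℕP
open import Data.Fin using (Fin; punchIn; toℕ)
open import Data.Fin.Properties using (_≟_)
open import Data.Bool using (Bool; true; false; _∨_; _∧_; not; T)
open import Data.Bool.Properties using (∨-comm; ∧-comm)
open import Relation.Nullary using (¬_; does; yes; no)
open import Relation.Binary.PropositionalEquality
  using (_≡_; _≢_; refl; sym; trans; cong; cong₂)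
open import Function.Bundles using (_⤖_; Bijection)

record Graph (n : ℕ) : Set where
  field
    adj   : Fin n → Fin n → Bool
    adj-sym   : ∀ x y → adj x y ≡ adj y x
    adj-irref : ∀ x → adj x x ≡ false
open Graph public

_==_ : ∀ {n} → Fin n → Fin n → Bool
x == y = does (x ≟ y)

==-sym : ∀ {n} (x y : Fin n) → (x == y) ≡ (y == x)
==-sym x y with x ≟ y | y ≟ x
... | yes _ | yes _ = refl
... | no _  | no _  = refl
... | yes p | no q  = Data.Empty.⊥-elim (q (sym p)) where import Data.Empty
... | no p  | yes q = Data.Empty.⊥-elim (p (sym q)) where import Data.Empty

==-refl : ∀ {n} (x : Fin n) → (x == x) ≡ true
==-refl x with x ≟ x
... | yes _ = refl
... | no p  = Data.Empty.⊥-elim (p refl) where import Data.Empty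

complement : ∀ {n} → Graph n → Graph n
complement G = record
  { adj       = λ x y → not (x == y) ∧ not (adj G x y)
  ; adj-sym   = λ x y → cong₂ (λ a b → not a ∧ not b) (==-sym x y) (adj-sym G x y)
  ; adj-irref = λ x → cong (λ a → not a ∧ not (adj G x x)) (==-refl x)
  }

-- The cycle C_n on vertices 0,…,n-1: distinct i, j adjacent iff
-- j ≡ i + 1 (mod n) or i ≡ j + 1 (mod n).  (Intended for n ≥ 3.)

succMod : ∀ {n} → Fin n → Fin n → Bool
succMod {zero}  a b = false
succMod {suc k} a b = does (((toℕ a + 1) % suc k) ℕP.≟ toℕ b)

cycle : (n : ℕ) → Graph n
cycle n = record
  { adj       = λ i j → not (i == j) ∧ (succMod i j ∨ succMod j i)
  ; adj-sym   = λ i j → cong₂ (λ a b → not a ∧ b) (==-sym i j) (∨-comm (succMod i j) (succMod j i))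
  ; adj-irref = λ i → cong (λ a → not a ∧ (succMod i i ∨ succMod i i)) (==-refl i)
  }

deleteVertex : ∀ {n} → Graph (suc n) → Fin (suc n) → Graph n
deleteVertex G v = record
  { adj       = λ x y → adj G (punchIn v x) (punchIn v y)
  ; adj-sym   = λ x y → adj-sym G (punchIn v x) (punchIn v y)
  ; adj-irref = λ x → adj-irref G (punchIn v x)
  }

-- The vertex v is
-- removed and merged into u: vertex x of G / uv corresponds to vertex
-- (punchIn v x) of G; the merged vertex is the one corresponding to u.

contrRaw : ∀ {n} → Graph n → Fin n → Fin n → Fin n → Fin n → Bool
contrRaw G u x' y' v =
  not (x' == y') ∧ (adj G x' y' ∨ ((x' == u) ∧ adj G v y') ∨ ((y' == u) ∧ adj G x' v))

contrAdj : ∀ {n} → Graph (suc n) → Fin (suc n) → Fin (suc n) → Fin n → Fin n → Bool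
contrAdj G u v x y = contrRaw G u (punchIn v x) (punchIn v y) v

contract : ∀ {n} (G : Graph (suc n)) (u v : Fin (suc n)) → T (adj G u v) → Graph n
contract G u v _ = record
  { adj       = contrAdj G u v
  ; adj-sym   = λ x y → let x' = punchIn v x ; y' = punchIn v y in
      cong₂ (λ a b → not a ∧ b) (==-sym x' y')
        (trans (cong (λ a → a ∨ (((x' == u) ∧ adj G v y') ∨ ((y' == u) ∧ adj G x' v)))
                     (adj-sym G x' y'))
          (cong (adj G y' x' ∨_)
            (trans (∨-comm ((x' == u) ∧ adj G v y') ((y' == u) ∧ adj G x' v))
                   (cong₂ (λ a b → ((y' == u) ∧ a) ∨ ((x' == u) ∧ b))
                          (adj-sym G x' v) (adj-sym G v y')))))
  ; adj-irref = λ x → let x' = punchIn v x in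
      cong (λ a → not a ∧ (adj G x' x' ∨ ((x' == u) ∧ adj G v x') ∨ ((x' == u) ∧ adj G x' v))) (==-refl x')
  }

record _≅_ {m n : ℕ} (H : Graph m) (G : Graph n) : Set where
  field
    bij      : Fin m ⤖ Fin n
    preserve : ∀ x y → adj H x y ≡ adj G (Bijection.to bij x) (Bijection.to bij y)

data _≤IM_ {m : ℕ} (H : Graph m) : {n : ℕ} → Graph n → Set where
  iso  : ∀ {n} {G : Graph n} → H ≅ G → H ≤IM G
  del  : ∀ {n} {G : Graph (suc n)} (v : Fin (suc n)) →
         H ≤IM deleteVertex G v → H ≤IM G
  con  : ∀ {n} {G : Graph (suc n)} (u v : Fin (suc n)) (e : T (adj G u v)) →
         H ≤IM contract G u v e → H ≤IM G

module Submission where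

open import Defs
open import Data.Nat using (ℕ; zero; suc; pred; _+_; _*_; _/_; _%_; _≤_; _<_; _≥_; s≤s; z≤n; NonZero)
open import Data.Nat.Properties
  using (+-comm; +-suc; +-assoc; +-cancelˡ-≡; suc-pred; ≡ᵇ⇒≡; ≡⇒≡ᵇ; <-trans; ≤-refl; ≤-trans)
open import Data.Nat.DivMod
  using (_mod_; m%n<n; %-distribˡ-+; m%n%n≡m%n; m<n⇒m%n≡m; m≡m%n+[m/n]*n; %-remove-+ˡ)
open import Data.Nat.Divisibility
  using (_∣_; ∣m+n∣m⇒∣n; n∣m*n; ∣-refl; ∣-antisym; >⇒∤; m%n≡0⇔n∣m)
open import Data.Fin as Fin using (Fin; toℕ; punchIn)
open import Data.Fin.Properties
  using (_≟_; toℕ-injective; toℕ-fromℕ<; fromℕ<-cong; toℕ<n; punchIn-injective)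
open import Data.Bool using (true; false; T; not)
open import Data.Bool.Properties using (T-∧; T-∨; T-not-≡)
open import Data.Product using (_,_; proj₂)
open import Data.Sum as Sum using (_⊎_; inj₁; inj₂)
open import Function using (_∘_)
open import Function.Bundles using (_⇔_; mk⇔; Bijection; Equivalence)
open import Function.Definitions using (Injective)
open import Function.Properties.Equivalence using () renaming (trans to ⇔-trans)
open import Relation.Nullary using (¬_; contradiction)
open import Relation.Nullary.Decidable using (dec-false)
open import Relation.Binary.PropositionalEquality
  using (_≡_; _≢_; refl; sym; trans; cong; subst; module ≡-Reasoning)

-- An induced-minor relation H ≤IM G yields an injection V(H) → V(G) that
-- reflects adjacency (a vertex of the minor goes to a vertex of its branch
-- set; deletion and contraction never remove an edge between surviving
-- vertices), i.e. non-edges of H go to non-edges of G.  For the complements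
-- of C_m and C_n this sends consecutive vertices of C_m to adjacent vertices
-- of C_n, so q ↦ f(q mod m) is a walk in C_n that returns to its start
-- exactly at the multiples of m.  For m ≥ 3 it cannot backtrack, hence runs
-- around C_n in one direction and returns exactly at the multiples of n.
-- Thus m ∣ n and n ∣ m.

record AdjReflectingInjection {m n : ℕ} (H : Graph m) (G : Graph n) : Set where
  field
    to           : Fin m → Fin n
    injective    : Injective _≡_ _≡_ to
    reflects-adj : ∀ i j → T (adj G (to i) (to j)) → T (adj H i j)

open AdjReflectingInjection

adj⇒≢ : ∀ {n} (G : Graph n) {x y} → T (adj G x y) → x ≢ y
adj⇒≢ G {x} a refl = subst T (adj-irref G x) a

≢⇒T-not-== : ∀ {n} {x y : Fin n} → x ≢ y → T (not (x == y))
≢⇒T-not-== {x = x} {y} x≢y = Equivalence.from T-not-≡ (dec-false (x ≟ y) x≢y)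

module _ {l m n : ℕ} {F : Graph l} {H : Graph m} {G : Graph n} where

  ∘-reflecting : AdjReflectingInjection H G → AdjReflectingInjection F H → AdjReflectingInjection F G
  ∘-reflecting g f = record
    { to           = to g ∘ to f
    ; injective    = injective f ∘ injective g
    ; reflects-adj = λ i j → reflects-adj f i j ∘ reflects-adj g (to f i) (to f j)
    }

≅⇒reflecting : ∀ {m n} {H : Graph m} {G : Graph n} → H ≅ G → AdjReflectingInjection H G
≅⇒reflecting h = record
  { to           = Bijection.to bij
  ; injective    = Bijection.injective bij
  ; reflects-adj = λ i j → subst T (sym (preserve i j))
  }
  where open _≅_ h

deleteVertex-reflecting : ∀ {n} (G : Graph (suc n)) v → AdjReflectingInjection (deleteVertex G v) G
deleteVertex-reflecting G v = record
  { to           = punchIn v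
  ; injective    = punchIn-injective v _ _
  ; reflects-adj = λ _ _ a → a
  }

contract-reflecting : ∀ {n} (G : Graph (suc n)) u v e → AdjReflectingInjection (contract G u v e) G
contract-reflecting G u v e = record
  { to           = punchIn v
  ; injective    = punchIn-injective v _ _
  ; reflects-adj = λ _ _ a →
      Equivalence.from T-∧ (≢⇒T-not-== (adj⇒≢ G a) , Equivalence.from T-∨ (inj₁ a))
  }

≤IM⇒reflecting : ∀ {m n} {H : Graph m} {G : Graph n} → H ≤IM G → AdjReflectingInjection H G
≤IM⇒reflecting         (iso h)       = ≅⇒reflecting h
≤IM⇒reflecting {G = G} (del v p)     = ∘-reflecting (deleteVertex-reflecting G v) (≤IM⇒reflecting p)
≤IM⇒reflecting {G = G} (con u v e p) = ∘-reflecting (contract-reflecting G u v e) (≤IM⇒reflecting p)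

¬T-not⇒T : ∀ {b} → ¬ T (not b) → T b
¬T-not⇒T {false} ¬t = ¬t _
¬T-not⇒T {true}  _  = _

module _ {n : ℕ} (G : Graph n) {x y : Fin n} where

  adj⇒¬adj-complement : T (adj G x y) → ¬ T (adj (complement G) x y)
  adj⇒¬adj-complement a c =
    subst T (Equivalence.to T-not-≡ (proj₂ (Equivalence.to T-∧ c))) a

  ¬adj-complement⇒adj : x ≢ y → ¬ T (adj (complement G) x y) → T (adj G x y)
  ¬adj-complement⇒adj x≢y ¬c =
    ¬T-not⇒T (λ t → ¬c (Equivalence.from T-∧ (≢⇒T-not-== x≢y , t)))

module Rotation (n : ℕ) .{{_ : NonZero n}} where

  open ≡-Reasoning

  [m+n%d]%d≡[m+n]%d : ∀ k a → (k + a % n) % n ≡ (k + a) % n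
  [m+n%d]%d≡[m+n]%d k a = begin
    (k + a % n) % n         ≡⟨ %-distribˡ-+ k (a % n) n ⟩
    (k % n + a % n % n) % n ≡⟨ cong (λ x → (k % n + x) % n) (m%n%n≡m%n a n) ⟩
    (k % n + a % n) % n     ≡⟨ %-distribˡ-+ k a n ⟨
    (k + a) % n             ∎

  %-shift-≡⇒∣ : ∀ k a → (k + a) % n ≡ a % n → n ∣ k
  %-shift-≡⇒∣ k a eq = ∣m+n∣m⇒∣n (subst (n ∣_) qn≡pn+k (n∣m*n ((k + a) / n))) (n∣m*n (a / n))
    where
    qn≡pn+k : (k + a) / n * n ≡ a / n * n + k
    qn≡pn+k = +-cancelˡ-≡ (a % n) _ _ (begin
      a % n + (k + a) / n * n       ≡⟨ cong (_+ (k + a) / n * n) eq ⟨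
      (k + a) % n + (k + a) / n * n ≡⟨ m≡m%n+[m/n]*n (k + a) n ⟨
      k + a                         ≡⟨ cong (k +_) (m≡m%n+[m/n]*n a n) ⟩
      k + (a % n + a / n * n)       ≡⟨ +-comm k _ ⟩
      a % n + a / n * n + k         ≡⟨ +-assoc (a % n) _ k ⟩
      a % n + (a / n * n + k)       ∎)

  shift-fixes⇔∣ : ∀ k {a} → a < n → (k + a) % n ≡ a ⇔ n ∣ k
  shift-fixes⇔∣ k {a} a<n = subst (λ x → (k + a) % n ≡ x ⇔ n ∣ k) (m<n⇒m%n≡m a<n)
    (mk⇔ (%-shift-≡⇒∣ k a) (%-remove-+ˡ a))

  rotate : ℕ → ℕ
  rotate a = suc a % n

  rotate-% : ∀ q → rotate (q % n) ≡ suc q % n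
  rotate-% = [m+n%d]%d≡[m+n]%d 1

  rotate-injective : ∀ {a b} → a < n → b < n → rotate a ≡ rotate b → a ≡ b
  rotate-injective {a} {b} a<n b<n eq = begin
    a                       ≡⟨ unrotate a<n ⟨
    (pred n + rotate a) % n ≡⟨ cong (λ x → (pred n + x) % n) eq ⟩
    (pred n + rotate b) % n ≡⟨ unrotate b<n ⟩
    b                       ∎
    where
    unrotate : ∀ {a} → a < n → (pred n + rotate a) % n ≡ a
    unrotate {a} a<n = begin
      (pred n + rotate a) % n ≡⟨ [m+n%d]%d≡[m+n]%d (pred n) (suc a) ⟩
      (pred n + suc a) % n    ≡⟨ cong (_% n) (+-suc (pred n) a) ⟩
      (suc (pred n) + a) % n  ≡⟨ cong (λ x → (x + a) % n) (suc-pred n) ⟩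
      (n + a) % n             ≡⟨ %-remove-+ˡ a ∣-refl ⟩
      a % n                   ≡⟨ m<n⇒m%n≡m a<n ⟩
      a                       ∎

  module NonBacktrackingWalk
    (t : ℕ → ℕ) (t<n : ∀ q → t q < n)
    (step : ∀ q → rotate (t q) ≡ t (suc q) ⊎ rotate (t (suc q)) ≡ t q)
    (non-backtracking : ∀ q → t (suc (suc q)) ≢ t q)
    where

    Forward Backward : Set
    Forward  = ∀ q → rotate (t q) ≡ t (suc q)
    Backward = ∀ q → rotate (t (suc q)) ≡ t q

    forward : rotate (t 0) ≡ t 1 → Forward
    forward f zero = f
    forward f (suc q) with step (suc q)
    ... | inj₁ f′ = f′
    ... | inj₂ b  = contradiction
      (rotate-injective (t<n _) (t<n q) (trans b (sym (forward f q)))) (non-backtracking q)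

    backward : rotate (t 1) ≡ t 0 → Backward
    backward b zero = b
    backward b (suc q) with step (suc q)
    ... | inj₁ f  = contradiction (trans (sym f) (backward b q)) (non-backtracking q)
    ... | inj₂ b′ = b′

    forward-or-backward : Forward ⊎ Backward
    forward-or-backward with step 0
    ... | inj₁ f = inj₁ (forward f)
    ... | inj₂ b = inj₂ (backward b)

    forward-position : Forward → ∀ k → t k ≡ (k + t 0) % n
    forward-position f zero    = sym (m<n⇒m%n≡m (t<n 0))
    forward-position f (suc k) = begin
      t (suc k)                ≡⟨ f k ⟨
      rotate (t k)             ≡⟨ cong rotate (forward-position f k) ⟩
      (1 + (k + t 0) % n) % n  ≡⟨ [m+n%d]%d≡[m+n]%d 1 (k + t 0) ⟩
      (suc k + t 0) % n        ∎

    backward-position : Backward → ∀ k → t 0 ≡ (k + t k) % n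
    backward-position b zero    = sym (m<n⇒m%n≡m (t<n 0))
    backward-position b (suc k) = begin
      t 0                            ≡⟨ backward-position b k ⟩
      (k + t k) % n                  ≡⟨ cong (λ x → (k + x) % n) (b k) ⟨
      (k + rotate (t (suc k))) % n   ≡⟨ [m+n%d]%d≡[m+n]%d k (suc (t (suc k))) ⟩
      (k + suc (t (suc k))) % n      ≡⟨ cong (_% n) (+-suc k _) ⟩
      (suc k + t (suc k)) % n        ∎

    returns⇔∣ : ∀ k → t k ≡ t 0 ⇔ n ∣ k
    returns⇔∣ k with forward-or-backward
    ... | inj₁ f = subst (λ x → x ≡ t 0 ⇔ n ∣ k) (sym (forward-position f k))
                     (shift-fixes⇔∣ k (t<n 0))
    ... | inj₂ b = subst (λ x → t k ≡ x ⇔ n ∣ k) (sym (backward-position b k))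
                     (⇔-trans (mk⇔ sym sym) (shift-fixes⇔∣ k (t<n k)))

module _ {N : ℕ} where

  open Rotation (suc N)

  succMod⇔rotate : ∀ {x y : Fin (suc N)} → T (succMod x y) ⇔ rotate (toℕ x) ≡ toℕ y
  succMod⇔rotate {x} = mk⇔
    (λ s → trans (cong (_% suc N) (+-comm 1 (toℕ x))) (≡ᵇ⇒≡ _ _ s))
    (λ r → ≡⇒≡ᵇ _ _ (trans (cong (_% suc N) (+-comm (toℕ x) 1)) r))

  cycle-adj⇒rotate : ∀ {x y} → T (adj (cycle (suc N)) x y) →
                     rotate (toℕ x) ≡ toℕ y ⊎ rotate (toℕ y) ≡ toℕ x
  cycle-adj⇒rotate a = Sum.map (Equivalence.to succMod⇔rotate) (Equivalence.to succMod⇔rotate)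
    (Equivalence.to T-∨ (proj₂ (Equivalence.to T-∧ a)))

  rotate⇒cycle-adj : ∀ {x y} → x ≢ y → rotate (toℕ x) ≡ toℕ y → T (adj (cycle (suc N)) x y)
  rotate⇒cycle-adj x≢y r = Equivalence.from T-∧
    (≢⇒T-not-== x≢y , Equivalence.from T-∨ (inj₁ (Equivalence.from succMod⇔rotate r)))

toℕ-mod : ∀ q n .{{_ : NonZero n}} → toℕ (q mod n) ≡ q % n
toℕ-mod q n = toℕ-fromℕ< (m%n<n q n)

module ComplementCycleInjection {M N : ℕ} (3≤m : 3 ≤ suc M)
  (f : AdjReflectingInjection (complement (cycle (suc M))) (complement (cycle (suc N)))) where

  private
    m n : ℕ
    m = suc M
    n = suc N
    module Rₘ = Rotation m
    module Rₙ = Rotation n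
  open ≡-Reasoning

  walk : ℕ → ℕ
  walk q = toℕ (to f (q mod m))

  walk-≡⇔ : ∀ j k → walk j ≡ walk k ⇔ j % m ≡ k % m
  walk-≡⇔ j k = mk⇔
    (λ e → trans (sym (toℕ-mod j m)) (trans (cong toℕ (injective f (toℕ-injective e))) (toℕ-mod k m)))
    (λ e → cong (toℕ ∘ to f) (fromℕ<-cong _ _ e _ _))

  walk-returns⇔∣ : ∀ k → walk k ≡ walk 0 ⇔ m ∣ k
  walk-returns⇔∣ k = ⇔-trans (walk-≡⇔ k 0) (m%n≡0⇔n∣m k m)

  walk-≢ : ∀ k .{{_ : NonZero k}} q → k < m → walk (k + q) ≢ walk q
  walk-≢ k q k<m e = >⇒∤ k<m (Rₘ.%-shift-≡⇒∣ k q (Equivalence.to (walk-≡⇔ (k + q) q) e))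

  walk-step : ∀ q → Rₙ.rotate (walk q) ≡ walk (suc q) ⊎ Rₙ.rotate (walk (suc q)) ≡ walk q
  walk-step q = cycle-adj⇒rotate (¬adj-complement⇒adj (cycle n) images-distinct images-non-adj)
    where
    i j : Fin m
    i = q mod m
    j = suc q mod m
    i≢j : i ≢ j
    i≢j e = walk-≢ 1 q (<-trans ≤-refl 3≤m) (cong (toℕ ∘ to f) (sym e))
    images-distinct : to f i ≢ to f j
    images-distinct = i≢j ∘ injective f
    consecutive-adj : T (adj (cycle m) i j)
    consecutive-adj = rotate⇒cycle-adj i≢j (begin
      Rₘ.rotate (toℕ i) ≡⟨ cong Rₘ.rotate (toℕ-mod q m) ⟩
      Rₘ.rotate (q % m) ≡⟨ Rₘ.rotate-% q ⟩
      suc q % m         ≡⟨ toℕ-mod (suc q) m ⟨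
      toℕ j             ∎)
    images-non-adj : ¬ T (adj (complement (cycle n)) (to f i) (to f j))
    images-non-adj = adj⇒¬adj-complement (cycle m) {i} {j} consecutive-adj ∘ reflects-adj f i j

  open Rₙ.NonBacktrackingWalk walk (λ q → toℕ<n (to f (q mod m))) walk-step (λ q → walk-≢ 2 q 3≤m)

  m≡n : m ≡ n
  m≡n = ∣-antisym
    (Equivalence.to (walk-returns⇔∣ n) (Equivalence.from (returns⇔∣ n) ∣-refl))
    (Equivalence.to (returns⇔∣ m) (Equivalence.from (walk-returns⇔∣ m) ∣-refl))

complement-cycle-reflecting⇒≡ : ∀ {m n} → 3 ≤ m →
  AdjReflectingInjection (complement (cycle m)) (complement (cycle n)) → m ≡ n
complement-cycle-reflecting⇒≡ {suc M} {zero}  _   f with to f Fin.zero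
... | ()
complement-cycle-reflecting⇒≡ {suc M} {suc N} 3≤m f = ComplementCycleInjection.m≡n 3≤m f

mainTheorem7 : ∀ (m n : ℕ) → m ≥ 6 → n ≥ 6 → m ≢ n →
    ¬ (complement (cycle m) ≤IM complement (cycle n))
mainTheorem7 m n m≥6 _ m≢n minor =
  m≢n (complement-cycle-reflecting⇒≡ (≤-trans (s≤s (s≤s (s≤s z≤n))) m≥6) (≤IM⇒reflecting minor))
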